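{- Let $n$ be a positive integer, $R$ a commutative ring, $u_{i,j}\in R$ for each $i\in[n]$ and $j\in[n+1]$, and $p_1,\ldots,p_n\in R$. Then $$\sum_{k=1}^n\det\left(u_{i,\,j+[k=i]}-p_j\,u_{i,j}\,[k=i]\right)_{i,j\in[n]}=\det\left(u_{i,\,j+[n=j]}\right)_{i,j\in[n]}-\Big(\sum_{k=1}^np_k\Big)\det\left(u_{i,j}\right)_{i,j\in[n]}.$$
   Context: $[m]=\{1,\ldots,m\}$. $[X]$ is the Iverson bracket ($1$ if $X$ is true, $0$ otherwise). $(a_{i,j})_{i,j\in[n]}$ is the $n\times n$ matrix with $(i,j)$-entry $a_{i,j}$. -}

module Defs where

open import Level using (Level)
open import Data.Nat using (ℕ; zero; suc)
open import Data.Fin using (Fin; zero; suc; punchIn; inject₁; fromℕ; _≟_; toℕ)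
open import Relation.Nullary using (yes; no)
open import Algebra.Bundles using (CommutativeRing)

module _ {c ℓ : Level} (R : CommutativeRing c ℓ) where
  open CommutativeRing R using (Carrier; _+_; _*_; -_; 0#; 1#)

  ∑ : ∀ {n} → (Fin n → Carrier) → Carrier
  ∑ {zero}  f = 0#
  ∑ {suc n} f = f zero + ∑ (λ k → f (suc k))

  sgn : ℕ → Carrier
  sgn zero    = 1#
  sgn (suc k) = - sgn k

  det : ∀ {n} → (Fin n → Fin n → Carrier) → Carrier
  det {zero}  M = 1#
  det {suc n} M =
    ∑ (λ j → sgn (toℕ j) * (M zero j * det (λ i k → M (suc i) (punchIn j k))))

  iv : ∀ {n} → Fin n → Fin n → Carrier
  iv k i with k ≟ i
  ... | yes _ = 1#
  ... | no  _ = 0#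

-- column index j + [k = i] ∈ [n+1] for j ∈ [n]  (0-based: suc j or inject₁ j)
shiftIf : ∀ {n} → Fin n → Fin n → Fin n → Fin (suc n)
shiftIf k i j with k ≟ i
... | yes _ = suc j
... | no  _ = inject₁ j

-- column index j + [j = n] ∈ [n+1] for j ∈ [n], n = suc m (last index is fromℕ m)
shiftLast : ∀ {m} → Fin (suc m) → Fin (suc (suc m))
shiftLast {m} j with j ≟ fromℕ m
... | yes _ = suc j
... | no  _ = inject₁ j

{-# OPTIONS --safe #-}
-- Write A = (u_{i,j}), B = (u_{i,j+1}) and C = (p_j u_{i,j}). The k-th matrix on the left is A with
-- row k replaced by row k of B − C, so by linearity of det in that row the left side is F(B) − F(C),
-- where F(X) = Σ_k det(A with row k replaced by row k of X). Expanding along the first row and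
-- inducting on the size, F(X) is also Σ_l det(A with column l replaced by column l of X): both are
-- the derivative of det(A + tX) at t = 0. For X = B every column replacement but the last creates
-- two equal adjacent columns, and the last one is (u_{i,j+[n=j]}); for X = C, replacing column l
-- by p_l times itself multiplies det A by p_l.
module Submission where

open import Defs
open import Level using (Level)
open import Data.Nat using (ℕ; zero; suc)
open import Data.Nat.Properties using (1+n≢n)
open import Data.Fin using (Fin; zero; suc; inject₁; fromℕ; punchIn; punchOut; toℕ; _≟_)
open import Data.Fin.Properties using (punchInᵢ≢i; punchIn-injective; punchIn-punchOut; toℕ-inject₁; suc-injective)
open import Data.Vec.Functional using (Vector; updateAt; removeAt; tail)
open import Data.Vec.Functional.Properties using (updateAt-updates; updateAt-minimal; map-updateAt-local)
open import Data.Empty using (⊥-elim)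
open import Data.Product using (∃; _×_; _,_)
open import Function using (_∘_; const)
open import Relation.Nullary using (yes; no)
open import Relation.Binary.PropositionalEquality as ≡ using (_≡_; _≢_; _≗_)
open import Algebra.Bundles using (CommutativeRing)

module _ {a} {A : Set a} where

  removeAt-updateAt : ∀ {n} (xs : Vector A (suc n)) (j : Fin (suc n)) (f : A → A) →
    removeAt (updateAt xs j f) j ≗ removeAt xs j
  removeAt-updateAt xs j f c = updateAt-minimal (punchIn j c) j xs (punchInᵢ≢i j c)

  removeAt-updateAt-punchIn : ∀ {n} (xs : Vector A (suc n)) (j : Fin (suc n)) (l : Fin n) (f : A → A) →
    removeAt (updateAt xs (punchIn j l) f) j ≗ updateAt (removeAt xs j) l f
  removeAt-updateAt-punchIn xs j l f c with c ≟ l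
  ... | yes ≡.refl = ≡.trans (updateAt-updates (punchIn j c) xs) (≡.sym (updateAt-updates c (removeAt xs j)))
  ... | no c≢l     = ≡.trans (updateAt-minimal (punchIn j c) (punchIn j l) xs (c≢l ∘ punchIn-injective j c l))
                             (≡.sym (updateAt-minimal c l (removeAt xs j) c≢l))

data PunchView {n} (j : Fin (suc n)) : Fin (suc n) → Set where
  at      : PunchView j j
  punched : ∀ l → PunchView j (punchIn j l)

punchView : ∀ {n} (j l : Fin (suc n)) → PunchView j l
punchView j l with j ≟ l
... | yes ≡.refl = at
... | no j≢l     = ≡.subst (PunchView j) (punchIn-punchOut j≢l) (punched (punchOut j≢l))

punchIn-adjacent : ∀ {n} (j : Fin (suc (suc n))) (a : Fin (suc n)) → j ≢ inject₁ a → j ≢ suc a →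
  ∃ λ (a′ : Fin n) → punchIn j (inject₁ a′) ≡ inject₁ a × punchIn j (suc a′) ≡ suc a
punchIn-adjacent         zero          zero    j≢a _     = ⊥-elim (j≢a ≡.refl)
punchIn-adjacent {suc n} zero          (suc a) _   _     = a , ≡.refl , ≡.refl
punchIn-adjacent         (suc zero)    zero    _   j≢a+1 = ⊥-elim (j≢a+1 ≡.refl)
punchIn-adjacent {suc n} (suc (suc j)) zero    _   _     = zero , ≡.refl , ≡.refl
punchIn-adjacent {suc n} (suc j) (suc a) j≢a j≢a+1
  with a′ , e , e′ ← punchIn-adjacent j a (j≢a ∘ ≡.cong suc) (j≢a+1 ∘ ≡.cong suc)
  = suc a′ , ≡.cong suc e , ≡.cong suc e′

suc≢inject₁ : ∀ {n} (a : Fin n) → suc a ≢ inject₁ a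
suc≢inject₁ a e = 1+n≢n (≡.trans (≡.cong toℕ e) (toℕ-inject₁ a))

module Determinant {c ℓ : Level} (R : CommutativeRing c ℓ) where
  open CommutativeRing R hiding (zero)
  open import Algebra.Properties.Ring ring using (-0#≈0#; -‿+-comm; -‿distribˡ-*; x[y-z]≈xy-xz; [y-z]x≈yx-zx)
  open import Algebra.Properties.CommutativeSemigroup *-commutativeSemigroup using (x∙yz≈y∙xz)
  open import Algebra.Properties.Semiring.Sum semiring
    using (sum; sum-cong-≋; sum-cong-≗; ∑-distrib-+; ∑-comm; sum-remove; *-distribˡ-sum; *-distribʳ-sum; sum-init-last; sum-replicate-zero)
  open import Relation.Binary.Reasoning.Setoid setoid

  Matrix : ℕ → Set c
  Matrix n = Fin n → Fin n → Carrier

  minor : ∀ {n} → Fin (suc n) → Matrix (suc n) → Matrix n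
  minor j A i k = A (suc i) (punchIn j k)

  setRow : ∀ {n} → Matrix n → Fin n → Vector Carrier n → Matrix n
  setRow A k x = updateAt A k (const x)

  setCol : ∀ {n} → Matrix n → Fin n → Vector Carrier n → Matrix n
  setCol A l y i = updateAt (A i) l (const (y i))

  ∑≡sum : ∀ {n} (f : Vector Carrier n) → ∑ R f ≡ sum f
  ∑≡sum {zero}  f = ≡.refl
  ∑≡sum {suc n} f = ≡.cong (f zero +_) (∑≡sum (f ∘ suc))

  sum-zero : ∀ {n} {f : Vector Carrier n} → (∀ i → f i ≈ 0#) → sum f ≈ 0#
  sum-zero {n} f≈0 = trans (sum-cong-≋ f≈0) (sum-replicate-zero n)

  sum-neg : ∀ {n} (f : Vector Carrier n) → sum (λ i → - f i) ≈ - sum f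
  sum-neg {zero}  f = sym -0#≈0#
  sum-neg {suc n} f = trans (+-congˡ (sum-neg (f ∘ suc))) (-‿+-comm _ _)

  sum-sub : ∀ {n} (f g : Vector Carrier n) → sum (λ i → f i - g i) ≈ sum f - sum g
  sum-sub f g = trans (∑-distrib-+ f (λ i → - g i)) (+-congˡ (sum-neg g))

  sum-supported-on-adjacent : ∀ {n} (f : Vector Carrier (suc (suc n))) (a : Fin (suc n)) →
    (∀ j → j ≢ inject₁ a → j ≢ suc a → f j ≈ 0#) → sum f ≈ f (inject₁ a) + f (suc a)
  sum-supported-on-adjacent f zero f≈0 = begin
    f zero + (f (suc zero) + sum (λ j → f (suc (suc j))))  ≈⟨ +-congˡ (+-congˡ (sum-zero (λ j → f≈0 (suc (suc j)) (λ ()) (λ ())))) ⟩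
    f zero + (f (suc zero) + 0#)                           ≈⟨ +-congˡ (+-identityʳ _) ⟩
    f zero + f (suc zero)                                  ∎
  sum-supported-on-adjacent {suc n} f (suc a) f≈0 = begin
    f zero + sum (f ∘ suc)                        ≈⟨ +-cong (f≈0 zero (λ ()) (λ ())) (sum-supported-on-adjacent (f ∘ suc) a f≈0′) ⟩
    0# + (f (suc (inject₁ a)) + f (suc (suc a)))  ≈⟨ +-identityˡ _ ⟩
    f (suc (inject₁ a)) + f (suc (suc a))         ∎
    where
    f≈0′ : ∀ j → j ≢ inject₁ a → j ≢ suc a → f (suc j) ≈ 0#
    f≈0′ j j≢a j≢a+1 = f≈0 (suc j) (j≢a ∘ suc-injective) (j≢a+1 ∘ suc-injective)

  sign : ∀ {n} → Fin n → Carrier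
  sign j = sgn R (toℕ j)

  laplace : ∀ {n} → Vector Carrier n → Vector Carrier n → Carrier
  laplace r d = sum (λ j → sign j * (r j * d j))

  det-laplace : ∀ {n} (A : Matrix (suc n)) → det R A ≡ laplace (A zero) (λ j → det R (minor j A))
  det-laplace A = ∑≡sum (λ j → sign j * (A zero j * det R (minor j A)))

  laplace-cong : ∀ {n} {r r′ d d′ : Vector Carrier n} →
    (∀ j → r j ≈ r′ j) → (∀ j → d j ≈ d′ j) → laplace r d ≈ laplace r′ d′
  laplace-cong r≈r′ d≈d′ = sum-cong-≋ (λ j → *-congˡ (*-cong (r≈r′ j) (d≈d′ j)))

  laplace-congʳ : ∀ {n} (r : Vector Carrier n) {d d′ : Vector Carrier n} →
    (∀ j → d j ≈ d′ j) → laplace r d ≈ laplace r d′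
  laplace-congʳ r = laplace-cong (λ _ → refl)

  laplace-subˡ : ∀ {n} (x y d : Vector Carrier n) →
    laplace (λ j → x j - y j) d ≈ laplace x d - laplace y d
  laplace-subˡ x y d = trans (sum-cong-≋ term) (sum-sub (λ j → sign j * (x j * d j)) (λ j → sign j * (y j * d j)))
    where
    term : ∀ j → sign j * ((x j - y j) * d j) ≈ sign j * (x j * d j) - sign j * (y j * d j)
    term j = trans (*-congˡ ([y-z]x≈yx-zx (d j) (x j) (y j))) (x[y-z]≈xy-xz (sign j) _ _)

  laplace-subʳ : ∀ {n} (r x y : Vector Carrier n) →
    laplace r (λ j → x j - y j) ≈ laplace r x - laplace r y
  laplace-subʳ r x y = trans (sum-cong-≋ term) (sum-sub (λ j → sign j * (r j * x j)) (λ j → sign j * (r j * y j)))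
    where
    term : ∀ j → sign j * (r j * (x j - y j)) ≈ sign j * (r j * x j) - sign j * (r j * y j)
    term j = trans (*-congˡ (x[y-z]≈xy-xz (r j) (x j) (y j))) (x[y-z]≈xy-xz (sign j) _ _)

  laplace-scale : ∀ {n} (a : Carrier) {r d r′ d′ : Vector Carrier n} →
    (∀ j → r j * d j ≈ a * (r′ j * d′ j)) → laplace r d ≈ a * laplace r′ d′
  laplace-scale a {r} {d} {r′} {d′} rd≈a·r′d′ = begin
    sum (λ j → sign j * (r j * d j))           ≈⟨ sum-cong-≋ (λ j → trans (*-congˡ (rd≈a·r′d′ j)) (x∙yz≈y∙xz (sign j) a (r′ j * d′ j))) ⟩
    sum (λ j → a * (sign j * (r′ j * d′ j)))  ≈⟨ *-distribˡ-sum a (λ j → sign j * (r′ j * d′ j)) ⟨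
    a * laplace r′ d′                         ∎

  laplace-sumʳ : ∀ {m n} (r : Vector Carrier n) (d : Fin m → Vector Carrier n) →
    sum (λ k → laplace r (d k)) ≈ laplace r (λ j → sum (λ k → d k j))
  laplace-sumʳ r d = begin
    sum (λ k → sum (λ j → sign j * (r j * d k j)))  ≈⟨ ∑-comm (λ k j → sign j * (r j * d k j)) ⟩
    sum (λ j → sum (λ k → sign j * (r j * d k j)))  ≈⟨ sum-cong-≋ (λ j → sum-cong-≋ (λ k → *-assoc (sign j) (r j) (d k j))) ⟨
    sum (λ j → sum (λ k → sign j * r j * d k j))    ≈⟨ sum-cong-≋ (λ j → *-distribˡ-sum (sign j * r j) (λ k → d k j)) ⟨
    sum (λ j → sign j * r j * sum (λ k → d k j))    ≈⟨ sum-cong-≋ (λ j → *-assoc (sign j) (r j) (sum (λ k → d k j))) ⟩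
    laplace r (λ j → sum (λ k → d k j))             ∎

  laplace-+ : ∀ {n} (r d r′ d′ : Vector Carrier n) →
    laplace r d + laplace r′ d′ ≈ sum (λ j → sign j * (r j * d j + r′ j * d′ j))
  laplace-+ r d r′ d′ = begin
    laplace r d + laplace r′ d′                                ≈⟨ ∑-distrib-+ (λ j → sign j * (r j * d j)) (λ j → sign j * (r′ j * d′ j)) ⟨
    sum (λ j → sign j * (r j * d j) + sign j * (r′ j * d′ j))  ≈⟨ sum-cong-≋ (λ j → distribˡ (sign j) (r j * d j) (r′ j * d′ j)) ⟨
    sum (λ j → sign j * (r j * d j + r′ j * d′ j))             ∎

  det-cong : ∀ {n} {A B : Matrix n} → (∀ i j → A i j ≈ B i j) → det R A ≈ det R B
  det-cong {zero}          A≈B = refl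
  det-cong {suc n} {A} {B} A≈B = begin
    det R A                                     ≡⟨ det-laplace A ⟩
    laplace (A zero) (λ j → det R (minor j A))  ≈⟨ laplace-cong (A≈B zero) (λ j → det-cong (λ i k → A≈B (suc i) (punchIn j k))) ⟩
    laplace (B zero) (λ j → det R (minor j B))  ≡⟨ det-laplace B ⟨
    det R B                                     ∎

  minor-setRow : ∀ {n} (j : Fin (suc n)) (k : Fin n) (A : Matrix (suc n)) x →
    ∀ i c → minor j (setRow A (suc k) x) i c ≡ setRow (minor j A) k (removeAt x j) i c
  minor-setRow j k A x i = ≡.cong-app (map-updateAt-local {f = _∘ punchIn j} {g = const x} {h = const (removeAt x j)} (tail A) k ≡.refl i)

  det-setRow-suc : ∀ {n} (A : Matrix (suc n)) (k : Fin n) x →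
    det R (setRow A (suc k) x) ≈ laplace (A zero) (λ j → det R (setRow (minor j A) k (removeAt x j)))
  det-setRow-suc A k x = begin
    det R (setRow A (suc k) x)                                     ≡⟨ det-laplace (setRow A (suc k) x) ⟩
    laplace (A zero) (λ j → det R (minor j (setRow A (suc k) x)))  ≈⟨ laplace-congʳ (A zero) (λ j → det-cong (λ i c → reflexive (minor-setRow j k A x i c))) ⟩
    laplace (A zero) (λ j → det R (setRow (minor j A) k (removeAt x j))) ∎

  det-setRow-sub : ∀ {n} (A : Matrix n) (k : Fin n) (x y : Vector Carrier n) →
    det R (setRow A k (λ j → x j - y j)) ≈ det R (setRow A k x) - det R (setRow A k y)
  det-setRow-sub {suc n} A zero x y = begin
    det R (setRow A zero (λ j → x j - y j))              ≡⟨ det-laplace (setRow A zero (λ j → x j - y j)) ⟩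
    laplace (λ j → x j - y j) (λ j → det R (minor j A))  ≈⟨ laplace-subˡ x y (λ j → det R (minor j A)) ⟩
    laplace x (λ j → det R (minor j A)) - laplace y (λ j → det R (minor j A))
      ≡⟨ ≡.cong₂ _-_ (det-laplace (setRow A zero x)) (det-laplace (setRow A zero y)) ⟨
    det R (setRow A zero x) - det R (setRow A zero y)    ∎
  det-setRow-sub {suc (suc n)} A (suc k) x y = begin
    det R (setRow A (suc k) (λ j → x j - y j))      ≈⟨ det-setRow-suc A k (λ j → x j - y j) ⟩
    laplace (A zero) (λ j → det R (setRow (minor j A) k (λ c → x (punchIn j c) - y (punchIn j c))))
                                                    ≈⟨ laplace-congʳ (A zero) (λ j → det-setRow-sub (minor j A) k (removeAt x j) (removeAt y j)) ⟩
    laplace (A zero) (λ j → dx j - dy j)            ≈⟨ laplace-subʳ (A zero) dx dy ⟩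
    laplace (A zero) dx - laplace (A zero) dy       ≈⟨ +-cong (det-setRow-suc A k x) (-‿cong (det-setRow-suc A k y)) ⟨
    det R (setRow A (suc k) x) - det R (setRow A (suc k) y) ∎
    where
    dx dy : Vector Carrier (suc (suc n))
    dx j = det R (setRow (minor j A) k (removeAt x j))
    dy j = det R (setRow (minor j A) k (removeAt y j))

  col : ∀ {n} → Fin n → Matrix n → Vector Carrier n
  col l B i = B i l

  det-minor-setCol-self : ∀ {n} (A : Matrix (suc n)) (j : Fin (suc n)) y →
    det R (minor j (setCol A j y)) ≈ det R (minor j A)
  det-minor-setCol-self A j y = det-cong (λ i c → reflexive (removeAt-updateAt (A (suc i)) j (const (y (suc i))) c))

  det-minor-setCol-punchIn : ∀ {n} (A : Matrix (suc n)) (j : Fin (suc n)) (l : Fin n) y →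
    det R (minor j (setCol A (punchIn j l) y)) ≈ det R (setCol (minor j A) l (tail y))
  det-minor-setCol-punchIn A j l y =
    det-cong (λ i c → reflexive (removeAt-updateAt-punchIn (A (suc i)) j l (const (y (suc i))) c))

  sum-setCol-cofactor : ∀ {n} (A B : Matrix (suc n)) (j : Fin (suc n)) →
    sum (λ l → setCol A l (col l B) zero j * det R (minor j (setCol A l (col l B))))
      ≈ B zero j * det R (minor j A) + A zero j * sum (λ l → det R (setCol (minor j A) l (col l (minor j B))))
  sum-setCol-cofactor A B j = begin
    sum T                                                       ≈⟨ sum-remove {i = j} T ⟩
    T j + sum (λ l → T (punchIn j l))                           ≈⟨ +-cong Tⱼ (sum-cong-≋ T-punchIn) ⟩
    B zero j * det R (minor j A) + sum (λ l → A zero j * D′ l)  ≈⟨ +-congˡ (*-distribˡ-sum (A zero j) D′) ⟨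
    B zero j * det R (minor j A) + A zero j * sum D′            ∎
    where
    T : Vector Carrier _
    T l = setCol A l (col l B) zero j * det R (minor j (setCol A l (col l B)))
    D′ : Vector Carrier _
    D′ l = det R (setCol (minor j A) l (col l (minor j B)))
    Tⱼ : T j ≈ B zero j * det R (minor j A)
    Tⱼ = *-cong (reflexive (updateAt-updates j (A zero))) (det-minor-setCol-self A j (col j B))
    T-punchIn : ∀ l → T (punchIn j l) ≈ A zero j * D′ l
    T-punchIn l = *-cong (reflexive (updateAt-minimal j (punchIn j l) (A zero) (punchInᵢ≢i j l ∘ ≡.sym)))
                         (det-minor-setCol-punchIn A j l (col (punchIn j l) B))

  sum-det-setRow≈sum-det-setCol : ∀ {n} (A B : Matrix n) →
    sum (λ k → det R (setRow A k (B k))) ≈ sum (λ l → det R (setCol A l (col l B)))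
  sum-det-setRow≈sum-det-setCol {zero}  A B = refl
  sum-det-setRow≈sum-det-setCol {suc n} A B = begin
    det R (setRow A zero (B zero)) + sum (λ k → det R (setRow A (suc k) (B (suc k))))
      ≈⟨ +-cong (reflexive (det-laplace (setRow A zero (B zero)))) (sum-cong-≋ (λ k → det-setRow-suc A k (B (suc k)))) ⟩
    laplace (B zero) dM + sum (λ k → laplace (A zero) (λ j → det R (setRow (minor j A) k (minor j B k))))
      ≈⟨ +-congˡ (laplace-sumʳ (A zero) (λ k j → det R (setRow (minor j A) k (minor j B k)))) ⟩
    laplace (B zero) dM + laplace (A zero) (λ j → sum (λ k → det R (setRow (minor j A) k (minor j B k))))
      ≈⟨ +-congˡ (laplace-congʳ (A zero) (λ j → sum-det-setRow≈sum-det-setCol (minor j A) (minor j B))) ⟩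
    laplace (B zero) dM + laplace (A zero) E
      ≈⟨ laplace-+ (B zero) dM (A zero) E ⟩
    sum (λ j → sign j * (B zero j * dM j + A zero j * E j))
      ≈⟨ sum-cong-≋ (λ j → *-congˡ {sign j} (sum-setCol-cofactor A B j)) ⟨
    sum (λ j → sign j * sum (λ l → T l j))
      ≈⟨ sum-cong-≋ (λ j → *-distribˡ-sum (sign j) (λ l → T l j)) ⟩
    sum (λ j → sum (λ l → sign j * T l j))
      ≈⟨ ∑-comm (λ l j → sign j * T l j) ⟨
    sum (λ l → laplace (setCol A l (col l B) zero) (λ j → det R (minor j (setCol A l (col l B)))))
      ≡⟨ sum-cong-≗ (λ l → det-laplace (setCol A l (col l B))) ⟨
    sum (λ l → det R (setCol A l (col l B)))
      ∎
    where
    dM E : Vector Carrier (suc n)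
    dM j = det R (minor j A)
    E j = sum (λ l → det R (setCol (minor j A) l (col l (minor j B))))
    T : Fin (suc n) → Fin (suc n) → Carrier
    T l j = setCol A l (col l B) zero j * det R (minor j (setCol A l (col l B)))

  det-setCol-scale : ∀ {n} (A : Matrix n) (l : Fin n) (a : Carrier) →
    det R (setCol A l (λ i → a * A i l)) ≈ a * det R A
  det-setCol-scale {suc n} A l a = begin
    det R (scaled l)                                            ≡⟨ det-laplace (scaled l) ⟩
    laplace (scaled l zero) (λ j → det R (minor j (scaled l)))  ≈⟨ laplace-scale a (λ j → cofactor j (punchView j l)) ⟩
    a * laplace (A zero) (λ j → det R (minor j A))              ≡⟨ ≡.cong (a *_) (det-laplace A) ⟨
    a * det R A                                                 ∎
    where
    scaled : Fin (suc n) → Matrix (suc n)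
    scaled l = setCol A l (λ i → a * A i l)
    cofactor : ∀ {l} j → PunchView j l →
      scaled l zero j * det R (minor j (scaled l)) ≈ a * (A zero j * det R (minor j A))
    cofactor j at = begin
      scaled j zero j * det R (minor j (scaled j))  ≈⟨ *-cong (reflexive (updateAt-updates j (A zero))) (det-minor-setCol-self A j (λ i → a * A i j)) ⟩
      a * A zero j * det R (minor j A)              ≈⟨ *-assoc a (A zero j) (det R (minor j A)) ⟩
      a * (A zero j * det R (minor j A))            ∎
    cofactor j (punched l) = begin
      scaled (punchIn j l) zero j * det R (minor j (scaled (punchIn j l)))
        ≈⟨ *-cong (reflexive (updateAt-minimal j (punchIn j l) (A zero) (punchInᵢ≢i j l ∘ ≡.sym))) (det-minor-setCol-punchIn A j l (λ i → a * A i (punchIn j l))) ⟩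
      A zero j * det R (setCol (minor j A) l (λ i → a * minor j A i l))
        ≈⟨ *-congˡ (det-setCol-scale (minor j A) l a) ⟩
      A zero j * (a * det R (minor j A))
        ≈⟨ x∙yz≈y∙xz (A zero j) a (det R (minor j A)) ⟩
      a * (A zero j * det R (minor j A))
        ∎

  removeAt-adjacent : ∀ {n} (g : Vector Carrier (suc (suc n))) (a : Fin (suc n)) →
    g (inject₁ a) ≈ g (suc a) → ∀ k → removeAt g (inject₁ a) k ≈ removeAt g (suc a) k
  removeAt-adjacent g zero    g≈ zero    = sym g≈
  removeAt-adjacent g zero    g≈ (suc k) = refl
  removeAt-adjacent g (suc a) g≈ zero    = refl
  removeAt-adjacent {suc n} g (suc a) g≈ (suc k) = removeAt-adjacent (tail g) a g≈ k

  det-adjacent-cols : ∀ {n} (A : Matrix (suc (suc n))) (a : Fin (suc n)) →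
    (∀ i → A i (inject₁ a) ≈ A i (suc a)) → det R A ≈ 0#
  det-minor-adjacent-cols : ∀ {n} (A : Matrix (suc (suc n))) (a : Fin (suc n)) →
    (∀ i → A i (inject₁ a) ≈ A i (suc a)) → ∀ j → j ≢ inject₁ a → j ≢ suc a → det R (minor j A) ≈ 0#

  det-adjacent-cols A a A≈ = begin
    det R A                    ≡⟨ det-laplace A ⟩
    sum f                      ≈⟨ sum-supported-on-adjacent f a vanish ⟩
    f (inject₁ a) + f (suc a)  ≈⟨ +-congʳ (*-cong (reflexive (≡.cong (sgn R) (toℕ-inject₁ a))) (*-cong (A≈ zero) minors≈)) ⟩
    sign a * y + - sign a * y  ≈⟨ +-congˡ (-‿distribˡ-* (sign a) y) ⟨
    sign a * y - sign a * y    ≈⟨ -‿inverseʳ (sign a * y) ⟩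
    0#                         ∎
    where
    f : Vector Carrier _
    f j = sign j * (A zero j * det R (minor j A))
    y : Carrier
    y = A zero (suc a) * det R (minor (suc a) A)
    vanish : ∀ j → j ≢ inject₁ a → j ≢ suc a → f j ≈ 0#
    vanish j j≢a j≢a+1 =
      trans (*-congˡ (trans (*-congˡ (det-minor-adjacent-cols A a A≈ j j≢a j≢a+1)) (zeroʳ _))) (zeroʳ _)
    minors≈ : det R (minor (inject₁ a) A) ≈ det R (minor (suc a) A)
    minors≈ = det-cong (λ i → removeAt-adjacent (A (suc i)) a (A≈ (suc i)))

  det-minor-adjacent-cols A a A≈ j j≢a j≢a+1 with punchIn-adjacent j a j≢a j≢a+1
  det-minor-adjacent-cols {zero}  A a A≈ j _ _ | () , _
  det-minor-adjacent-cols {suc n} A a A≈ j _ _ | a′ , e , e′ =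
    det-adjacent-cols (minor j A) a′ (λ i → ≡.subst₂ (λ x y → A (suc i) x ≈ A (suc i) y) (≡.sym e) (≡.sym e′) (A≈ (suc i)))

  sum-det-setCol-scale : ∀ {n} (A : Matrix n) (p : Vector Carrier n) →
    sum (λ l → det R (setCol A l (λ i → p l * A i l))) ≈ sum p * det R A
  sum-det-setCol-scale A p =
    trans (sum-cong-≋ (λ l → det-setCol-scale A l (p l))) (sym (*-distribʳ-sum (det R A) p))

  det-setCol-next-inject₁ : ∀ {m} (U : Fin (suc m) → Fin (suc (suc m)) → Carrier) (a : Fin m) →
    det R (setCol (λ i j → U i (inject₁ j)) (inject₁ a) (λ i → U i (suc (inject₁ a)))) ≈ 0#
  -- Column inject₁ a now holds column suc (inject₁ a) of U, which is also column suc a of the matrix.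
  det-setCol-next-inject₁ {suc m} U a = det-adjacent-cols (setCol A (inject₁ a) y) a (λ i → reflexive (≡.trans
    (updateAt-updates (inject₁ a) (A i))
    (≡.sym (updateAt-minimal (suc a) (inject₁ a) (A i) (suc≢inject₁ a)))))
    where
    A : Matrix (suc (suc m))
    A i j = U i (inject₁ j)
    y : Vector Carrier (suc (suc m))
    y i = U i (suc (inject₁ a))

  sum-det-setCol-next : ∀ {m} (U : Fin (suc m) → Fin (suc (suc m)) → Carrier) →
    sum (λ l → det R (setCol (λ i j → U i (inject₁ j)) l (λ i → U i (suc l)))) ≈ det R (λ i j → U i (shiftLast j))
  sum-det-setCol-next {m} U = begin
    sum T                              ≈⟨ sum-init-last T ⟩
    sum (T ∘ inject₁) + T (fromℕ m)    ≈⟨ +-congʳ (sum-zero (det-setCol-next-inject₁ U)) ⟩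
    0# + T (fromℕ m)                   ≈⟨ +-identityˡ (T (fromℕ m)) ⟩
    T (fromℕ m)                        ≈⟨ det-cong last-col ⟩
    det R (λ i j → U i (shiftLast j))  ∎
    where
    T : Vector Carrier (suc m)
    T l = det R (setCol (λ i j → U i (inject₁ j)) l (λ i → U i (suc l)))
    last-col : ∀ i j → setCol (λ i j → U i (inject₁ j)) (fromℕ m) (λ i → U i (suc (fromℕ m))) i j ≈ U i (shiftLast j)
    last-col i j with j ≟ fromℕ m
    ... | yes ≡.refl = reflexive (updateAt-updates (fromℕ m) (λ j → U i (inject₁ j)))
    ... | no j≢m     = reflexive (updateAt-minimal j (fromℕ m) (λ j → U i (inject₁ j)) j≢m)

  shiftIf-matrix≈setRow : ∀ {m} (u : Fin m → Fin (suc m) → Carrier) (p : Vector Carrier m) (k i j : Fin m) →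
    u i (shiftIf k i j) - (p j * u i (inject₁ j)) * iv R k i
      ≈ setRow (λ i j → u i (inject₁ j)) k (λ j → u k (suc j) - p j * u k (inject₁ j)) i j
  shiftIf-matrix≈setRow u p k i j with k ≟ i
  ... | yes ≡.refl = trans (+-congˡ (-‿cong (*-identityʳ _)))
                           (reflexive (≡.sym (≡.cong-app (updateAt-updates k (λ i j → u i (inject₁ j))) j)))
  ... | no k≢i     = trans (+-congˡ (trans (-‿cong (zeroʳ _)) -0#≈0#)) (trans (+-identityʳ _)
                           (reflexive (≡.sym (≡.cong-app (updateAt-minimal i k (λ i j → u i (inject₁ j)) (k≢i ∘ ≡.sym)) j))))

lemma16p4 : ∀ {c ℓ : Level} (R : CommutativeRing c ℓ) (m : ℕ)
            (u : Fin (suc m) → Fin (suc (suc m)) → CommutativeRing.Carrier R)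
            (p : Fin (suc m) → CommutativeRing.Carrier R) →
            let open CommutativeRing R in
            ∑ R (λ k → det R (λ i j → u i (shiftIf k i j) - (p j * u i (inject₁ j)) * iv R k i))
              ≈ det R (λ i j → u i (shiftLast j)) - ∑ R p * det R (λ i j → u i (inject₁ j))
lemma16p4 R m u p = begin
  ∑ R (λ k → det R (M k))
    ≡⟨ ∑≡sum (λ k → det R (M k)) ⟩
  sum (λ k → det R (M k))
    ≈⟨ sum-cong-≋ (λ k → det-cong (shiftIf-matrix≈setRow u p k)) ⟩
  sum (λ k → det R (setRow A k (λ j → B k j - C k j)))
    ≈⟨ sum-cong-≋ (λ k → det-setRow-sub A k (B k) (C k)) ⟩
  sum (λ k → det R (setRow A k (B k)) - det R (setRow A k (C k)))
    ≈⟨ sum-sub (λ k → det R (setRow A k (B k))) (λ k → det R (setRow A k (C k))) ⟩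
  sum (λ k → det R (setRow A k (B k))) - sum (λ k → det R (setRow A k (C k)))
    ≈⟨ +-cong (sum-det-setRow≈sum-det-setCol A B) (-‿cong (sum-det-setRow≈sum-det-setCol A C)) ⟩
  sum (λ l → det R (setCol A l (col l B))) - sum (λ l → det R (setCol A l (col l C)))
    ≈⟨ +-cong (sum-det-setCol-next u) (-‿cong (sum-det-setCol-scale A p)) ⟩
  det R (λ i j → u i (shiftLast j)) - sum p * det R A
    ≡⟨ ≡.cong (λ s → det R (λ i j → u i (shiftLast j)) - s * det R A) (∑≡sum p) ⟨
  det R (λ i j → u i (shiftLast j)) - ∑ R p * det R A
    ∎
  where
  open CommutativeRing R
  open Determinant R
  open import Algebra.Properties.Semiring.Sum semiring using (sum; sum-cong-≋)
  open import Relation.Binary.Reasoning.Setoid setoid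
  M : Fin (suc m) → Matrix (suc m)
  A B C : Matrix (suc m)
  M k i j = u i (shiftIf k i j) - (p j * u i (inject₁ j)) * iv R k i
  A i j = u i (inject₁ j)
  B i j = u i (suc j)
  C i j = p j * A i j
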